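{- Let $G$ be a finite simple graph that is hole-free and paraglider-free, let $A$ be an induced subgraph of $G$ isomorphic to $\overline{C_6}$, with its two triangles $\mathrm{left}(A)$ and $\mathrm{right}(A)$. Let $A^*$ be an induced subgraph of $G$ containing $A$ that is a matched co-bipartite graph and is maximal (under inclusion) with this property, with cliques $\mathrm{left}(A^*)\supseteq \mathrm{left}(A)$ and $\mathrm{right}(A^*)\supseteq\mathrm{right}(A)$. Let $A_6$ be the set of vertices outside $V(A)$ adjacent to all six vertices of $A$, and $A_3$ the set of vertices outside $V(A)$ with exactly three neighbors in $V(A)$. Then: (i) every vertex of $A_6$ is adjacent to every vertex of $V(A^*)$; (ii) if $x,y\in A_3$ are vertices not in $V(A^*)$ with $N(x)\cap V(A)=\mathrm{left}(A)$ and $N(y)\cap V(A)=\mathrm{right}(A)$, then $x$ and $y$ are nonadjacent.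
   Context: A hole is an induced chordless cycle with at least five vertices. A paraglider is the graph on five vertices $u_1,u_2,w_1,w_2,p$ with edges $u_1u_2$, $u_iw_j$ for $i,j\in\{1,2\}$, $pw_1$, $pw_2$ (the complement of $P_2\cup P_3$). A graph is $H$-free if it has no induced subgraph isomorphic to $H$. A matched co-bipartite graph consists of two disjoint cliques of the same size $k$, where the edges between the two cliques form a perfect matching ($k$ edges, called matching edges). $\overline{C_6}$ (the complement of the chordless 6-cycle) is the matched co-bipartite graph with $k=3$; its two triangles are denoted $\mathrm{left}(A)$ and $\mathrm{right}(A)$. -}

module Defs where

open import Data.Nat using (ℕ; zero; suc; _+_; _%_; _≡ᵇ_; _<ᵇ_)
open import Data.Fin using (Fin; toℕ; _≟_)
open import Data.Bool using (Bool; true; false; _∨_; not; if_then_else_)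
open import Data.Product using (Σ; _×_)
open import Data.Sum using (_⊎_)
open import Relation.Binary.PropositionalEquality using (_≡_; _≢_)
open import Relation.Nullary using (¬_)
open import Relation.Nullary.Decidable using (⌊_⌋)
open import Function.Definitions using (Injective)

record Graph : Set where
  field
    n      : ℕ
    adj    : Fin n → Fin n → Bool
    sym    : ∀ u v → adj u v ≡ adj v u
    irrefl : ∀ v → adj v v ≡ false

open Graph public

V : Graph → Set
V G = Fin (n G)

InducedCopy : (G : Graph) {m : ℕ} → (Fin m → Fin m → Bool) → (Fin m → V G) → Set
InducedCopy G {m} P f = Injective _≡_ _≡_ f × (∀ (i j : Fin m) → adj G (f i) (f j) ≡ P i j)

Contains : (G : Graph) {m : ℕ} → (Fin m → Fin m → Bool) → Set
Contains G {m} P = Σ (Fin m → V G) λ f → InducedCopy G P f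

cycleAdj : (m : ℕ) → Fin (5 + m) → Fin (5 + m) → Bool
cycleAdj m i j = ((suc (toℕ i) % (5 + m)) ≡ᵇ toℕ j) ∨ ((suc (toℕ j) % (5 + m)) ≡ᵇ toℕ i)

HoleFree : Graph → Set
HoleFree G = ∀ (m : ℕ) → ¬ Contains G (cycleAdj m)

-- paraglider: u1=0, u2=1, w1=2, w2=3, p=4
pgEdge : ℕ → ℕ → Bool
pgEdge 0 1 = true
pgEdge 0 2 = true
pgEdge 0 3 = true
pgEdge 1 2 = true
pgEdge 1 3 = true
pgEdge 2 4 = true
pgEdge 3 4 = true
pgEdge _ _ = false

paragliderAdj : Fin 5 → Fin 5 → Bool
paragliderAdj i j = pgEdge (toℕ i) (toℕ j) ∨ pgEdge (toℕ j) (toℕ i)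

ParagliderFree : Graph → Set
ParagliderFree G = ¬ Contains G paragliderAdj

-- complement of C6: left triangle {0,1,2}, right triangle {3,4,5},
-- matching edges 0-3, 1-4, 2-5
cbEdge : ℕ → ℕ → Bool
cbEdge 0 1 = true
cbEdge 0 2 = true
cbEdge 1 2 = true
cbEdge 3 4 = true
cbEdge 3 5 = true
cbEdge 4 5 = true
cbEdge 0 3 = true
cbEdge 1 4 = true
cbEdge 2 5 = true
cbEdge _ _ = false

coC6Adj : Fin 6 → Fin 6 → Bool
coC6Adj i j = cbEdge (toℕ i) (toℕ j) ∨ cbEdge (toℕ j) (toℕ i)

isLeft : Fin 6 → Bool
isLeft i = toℕ i <ᵇ 3

record MatchedCoBip (G : Graph) : Set where
  field
    k        : ℕ
    l        : Fin k → V G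
    r        : Fin k → V G
    l-inj    : Injective _≡_ _≡_ l
    r-inj    : Injective _≡_ _≡_ r
    disjoint : ∀ i j → l i ≢ r j
    l-clique : ∀ i j → i ≢ j → adj G (l i) (l j) ≡ true
    r-clique : ∀ i j → i ≢ j → adj G (r i) (r j) ≡ true
    matching : ∀ i j → adj G (l i) (r j) ≡ ⌊ i ≟ j ⌋

open MatchedCoBip public

_∈MCB_ : {G : Graph} → V G → MatchedCoBip G → Set
v ∈MCB B = Σ (Fin (k B)) λ i → (l B i ≡ v) ⊎ (r B i ≡ v)

countTrue : {m : ℕ} → (Fin m → Bool) → ℕ
countTrue {zero} f = 0
countTrue {suc m} f = (if f Fin.zero then 1 else 0) + countTrue (λ i → f (Fin.suc i))

InA6 : (G : Graph) → (Fin 6 → V G) → V G → Set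
InA6 G a v = (∀ i → a i ≢ v) × (∀ i → adj G v (a i) ≡ true)

InA3 : (G : Graph) → (Fin 6 → V G) → V G → Set
InA3 G a v = (∀ i → a i ≢ v) × (countTrue (λ i → adj G v (a i)) ≡ 3)

module Submission where

-- Part (i) is one configuration lemma; for part (ii) an edge xy would let
--     the configuration lemmas show that A* extends by xy, against maximality.

open import Defs
open import Data.Nat using (ℕ; _%_; _≡ᵇ_)
open import Data.Fin using (Fin; zero; suc; toℕ; _↑ˡ_; _↑ʳ_)
open import Data.Fin.Properties using (_≟_; any?)
open import Data.Bool using (Bool; true; false; not; _∨_; if_then_else_)
open import Data.Bool.Properties using (∨-comm)
open import Data.Unit using (⊤; tt)
open import Data.Product using (Σ; ∃; _×_; _,_; proj₁; proj₂)
open import Data.Sum using (_⊎_; inj₁; inj₂)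
open import Data.Vec using (Vec; []; _∷_; tabulate; lookup)
open import Data.Vec.Properties using (tabulate-cong)
import Data.Vec.Functional as Vector
open import Data.Empty using (⊥; ⊥-elim)
open import Function using (_∘_)
open import Function.Definitions using (Injective)
open import Relation.Binary.PropositionalEquality
  using (_≡_; _≢_; refl; trans; cong; cong₂; subst₂; module ≡-Reasoning)
  renaming (sym to ≡-sym)
open import Relation.Nullary using (Dec; ¬_; yes; no)
open import Relation.Nullary.Decidable using (⌊_⌋; isYes≗does; dec-true; dec-false; ⌊⌋-map′)

pattern i0 = zero
pattern i1 = suc i0
pattern i2 = suc i1
pattern i3 = suc i2
pattern i4 = suc i3
pattern i5 = suc i4

⌊⌋-true : {A : Set} (d : Dec A) → A → ⌊ d ⌋ ≡ true
⌊⌋-true d a = trans (isYes≗does d) (dec-true d a)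

⌊⌋-false : {A : Set} (d : Dec A) → ¬ A → ⌊ d ⌋ ≡ false
⌊⌋-false d ¬a = trans (isYes≗does d) (dec-false d ¬a)

closure-symmetric : {m : ℕ} (E : Fin m → Fin m → Bool) → ∀ i j → (E i j ∨ E j i) ≡ (E j i ∨ E i j)
closure-symmetric E i j = ∨-comm (E i j) (E j i)

module Copies (G : Graph) where

  infix 4 _~_ _≁_

  _~_ _≁_ : V G → V G → Set
  u ~ v = adj G u v ≡ true
  u ≁ v = adj G u v ≡ false

  adj-sym : {u v : V G} {b : Bool} → adj G u v ≡ b → adj G v u ≡ b
  adj-sym {u} {v} e = trans (Graph.sym G v u) e

  distinct-by : {u v d : V G} → u ~ d → v ≁ d → u ≢ v
  distinct-by u~d v≁d refl with trans (≡-sym u~d) v≁d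
  ... | ()

  adjacent⇒distinct : {u v : V G} → u ~ v → u ≢ v
  adjacent⇒distinct {u} u~v refl with trans (≡-sym u~v) (irrefl G u)
  ... | ()

  Realises : {m : ℕ} → (Fin m → Fin m → Bool) → (Fin m → V G) → Set
  Realises P f = ∀ i j → adj G (f i) (f j) ≡ P i j

  Above : {m : ℕ} → (Fin m → Fin m → Bool) → (Fin m → V G) → Set
  Above {ℕ.zero} P f = ⊤
  Above {ℕ.suc m} P f = (∀ j → adj G (f zero) (f (suc j)) ≡ P zero (suc j))
                      × Above (λ i j → P (suc i) (suc j)) (f ∘ suc)

  above⇒realises : {m : ℕ} {P : Fin m → Fin m → Bool} {f : Fin m → V G}
    → (∀ i j → P i j ≡ P j i) → (∀ i → P i i ≡ false) → Above P f → Realises P f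
  above⇒realises {ℕ.suc m} {P} {f} P-sym P-irr (row , rest) = realises
    where
    realises : Realises P f
    realises zero zero = trans (irrefl G (f zero)) (≡-sym (P-irr zero))
    realises zero (suc j) = row j
    realises (suc i) zero = trans (adj-sym (row i)) (P-sym zero (suc i))
    realises (suc i) (suc j) =
      above⇒realises (λ i j → P-sym (suc i) (suc j)) (P-irr ∘ suc) rest i j

  -- A realisation of P is injective as soon as each pattern vertex i can be
  -- decoded from its row of P together with one bit `tag` known about f i
  -- (the bit is needed to separate non-adjacent twins of the pattern).
  decodable⇒injective : {m : ℕ} {P : Fin m → Fin m → Bool} {f : Fin m → V G}
    → Realises P f → (tag : V G → Bool) (decode : Vec Bool m → Bool → Fin m)
    → (∀ i → decode (tabulate (P i)) (tag (f i)) ≡ i) → Injective _≡_ _≡_ f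
  decodable⇒injective {P = P} {f} realises tag decode decodes {i} {j} fi≡fj = begin
    i                                    ≡⟨ ≡-sym (decodes i) ⟩
    decode (tabulate (P i)) (tag (f i))  ≡⟨ cong₂ decode (tabulate-cong same-row) (cong tag fi≡fj) ⟩
    decode (tabulate (P j)) (tag (f j))  ≡⟨ decodes j ⟩
    j                                    ∎
    where
    open ≡-Reasoning
    same-row : ∀ k → P i k ≡ P j k
    same-row k = trans (≡-sym (realises i k))
                   (trans (cong (λ u → adj G u (f k)) fi≡fj) (realises j k))

module Forbidden (G : Graph) where
  open Copies G

  decodeC5 : Vec Bool 5 → Bool → Fin 5
  decodeC5 (false ∷ true ∷ false ∷ false ∷ true ∷ []) _ = i0
  decodeC5 (true ∷ false ∷ true ∷ false ∷ false ∷ []) _ = i1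
  decodeC5 (false ∷ true ∷ false ∷ true ∷ false ∷ []) _ = i2
  decodeC5 (false ∷ false ∷ true ∷ false ∷ true ∷ []) _ = i3
  decodeC5 _ _ = i4

  decodeC6 : Vec Bool 6 → Bool → Fin 6
  decodeC6 (false ∷ true ∷ false ∷ false ∷ false ∷ true ∷ []) _ = i0
  decodeC6 (true ∷ false ∷ true ∷ false ∷ false ∷ false ∷ []) _ = i1
  decodeC6 (false ∷ true ∷ false ∷ true ∷ false ∷ false ∷ []) _ = i2
  decodeC6 (false ∷ false ∷ true ∷ false ∷ true ∷ false ∷ []) _ = i3
  decodeC6 (false ∷ false ∷ false ∷ true ∷ false ∷ true ∷ []) _ = i4
  decodeC6 _ _ = i5

  decodeParaglider : Vec Bool 5 → Bool → Fin 5
  decodeParaglider (false ∷ true ∷ true ∷ true ∷ false ∷ []) _ = i0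
  decodeParaglider (true ∷ false ∷ true ∷ true ∷ false ∷ []) _ = i1
  decodeParaglider (true ∷ true ∷ false ∷ false ∷ true ∷ []) isW1 = if isW1 then i2 else i3
  decodeParaglider _ _ = i4

  no-C5 : HoleFree G → (v0 v1 v2 v3 v4 : V G)
    → v0 ~ v1 → v1 ~ v2 → v2 ~ v3 → v3 ~ v4 → v4 ~ v0
    → v0 ≁ v2 → v0 ≁ v3 → v1 ≁ v3 → v1 ≁ v4 → v2 ≁ v4 → ⊥
  no-C5 hf v0 v1 v2 v3 v4 e01 e12 e23 e34 e40 n02 n03 n13 n14 n24 =
    hf 0 (f , decodable⇒injective realises (λ _ → true) decodeC5
                (λ { i0 → refl ; i1 → refl ; i2 → refl ; i3 → refl ; i4 → refl }) , realises)
    where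
    f : Fin 5 → V G
    f = lookup (v0 ∷ v1 ∷ v2 ∷ v3 ∷ v4 ∷ [])
    rows : Above (cycleAdj 0) f
    rows =
      ( (λ { i0 → e01 ; i1 → n02 ; i2 → n03 ; i3 → adj-sym e40 })
      , (λ { i0 → e12 ; i1 → n13 ; i2 → n14 })
      , (λ { i0 → e23 ; i1 → n24 })
      , (λ { i0 → e34 })
      , (λ ())
      , tt )
    realises : Realises (cycleAdj 0) f
    realises = above⇒realises (closure-symmetric (λ i j → (ℕ.suc (toℕ i) % 5) ≡ᵇ toℕ j))
      (λ { i0 → refl ; i1 → refl ; i2 → refl ; i3 → refl ; i4 → refl }) rows

  no-C6 : HoleFree G → (v0 v1 v2 v3 v4 v5 : V G)
    → v0 ~ v1 → v1 ~ v2 → v2 ~ v3 → v3 ~ v4 → v4 ~ v5 → v5 ~ v0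
    → v0 ≁ v2 → v0 ≁ v3 → v0 ≁ v4 → v1 ≁ v3 → v1 ≁ v4 → v1 ≁ v5
    → v2 ≁ v4 → v2 ≁ v5 → v3 ≁ v5 → ⊥
  no-C6 hf v0 v1 v2 v3 v4 v5 e01 e12 e23 e34 e45 e50 n02 n03 n04 n13 n14 n15 n24 n25 n35 =
    hf 1 (f , decodable⇒injective realises (λ _ → true) decodeC6
                (λ { i0 → refl ; i1 → refl ; i2 → refl ; i3 → refl ; i4 → refl ; i5 → refl })
            , realises)
    where
    f : Fin 6 → V G
    f = lookup (v0 ∷ v1 ∷ v2 ∷ v3 ∷ v4 ∷ v5 ∷ [])
    rows : Above (cycleAdj 1) f
    rows =
      ( (λ { i0 → e01 ; i1 → n02 ; i2 → n03 ; i3 → n04 ; i4 → adj-sym e50 })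
      , (λ { i0 → e12 ; i1 → n13 ; i2 → n14 ; i3 → n15 })
      , (λ { i0 → e23 ; i1 → n24 ; i2 → n25 })
      , (λ { i0 → e34 ; i1 → n35 })
      , (λ { i0 → e45 })
      , (λ ())
      , tt )
    realises : Realises (cycleAdj 1) f
    realises = above⇒realises (closure-symmetric (λ i j → (ℕ.suc (toℕ i) % 6) ≡ᵇ toℕ j))
      (λ { i0 → refl ; i1 → refl ; i2 → refl ; i3 → refl ; i4 → refl ; i5 → refl }) rows

  no-paraglider : ParagliderFree G → (u1 u2 w1 w2 p : V G) → w1 ≢ w2
    → u1 ~ u2 → u1 ~ w1 → u1 ~ w2 → u2 ~ w1 → u2 ~ w2 → w1 ~ p → w2 ~ p
    → u1 ≁ p → u2 ≁ p → w1 ≁ w2 → ⊥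
  no-paraglider pf u1 u2 w1 w2 p w1≢w2 e12 e13 e14 e23 e24 e35 e45 n15 n25 n34 =
    pf (f , decodable⇒injective realises isW1 decodeParaglider
              (λ { i0 → refl ; i1 → refl ; i2 → cong (if_then i2 else i3) (⌊⌋-true (w1 ≟ w1) refl)
                 ; i3 → cong (if_then i2 else i3) (⌊⌋-false (w2 ≟ w1) (w1≢w2 ∘ ≡-sym)) ; i4 → refl })
        , realises)
    where
    f : Fin 5 → V G
    f = lookup (u1 ∷ u2 ∷ w1 ∷ w2 ∷ p ∷ [])
    isW1 : V G → Bool
    isW1 v = ⌊ v ≟ w1 ⌋
    rows : Above paragliderAdj f
    rows =
      ( (λ { i0 → e12 ; i1 → e13 ; i2 → e14 ; i3 → n15 })
      , (λ { i0 → e23 ; i1 → e24 ; i2 → n25 })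
      , (λ { i0 → n34 ; i1 → e35 })
      , (λ { i0 → e45 })
      , (λ ())
      , tt )
    realises : Realises paragliderAdj f
    realises = above⇒realises (closure-symmetric (λ i j → pgEdge (toℕ i) (toℕ j)))
      (λ { i0 → refl ; i1 → refl ; i2 → refl ; i3 → refl ; i4 → refl }) rows

  -- Let v, w be common neighbours of an edge u1u2, let w' be a neighbour of w
  -- missing u1, u2, and let z see v and w' but neither u2 nor w.  Then v ~ w:
  -- otherwise u1 u2 v w w' is a paraglider (v ~ w') or v u2 w w' z a C5.
  joined-via-private-neighbour : HoleFree G → ParagliderFree G → (u1 u2 v w w' z : V G)
    → u1 ~ u2 → u1 ~ v → u2 ~ v → u1 ~ w → u2 ~ w
    → w ~ w' → u1 ≁ w' → u2 ≁ w'
    → z ~ v → z ~ w' → z ≁ u2 → z ≁ w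
    → v ~ w
  joined-via-private-neighbour hf pf u1 u2 v w w' z
    u1u2 u1v u2v u1w u2w ww' u1w' u2w' zv zw' zu2 zw with adj G v w in vw
  ... | true = refl
  ... | false with adj G v w' in vw'
  ...   | true = ⊥-elim (no-paraglider pf u1 u2 v w w' (distinct-by (adj-sym zv) (adj-sym zw))
                   u1u2 u1v u1w u2v u2w vw' ww' u1w' u2w' vw)
  ...   | false = ⊥-elim (no-C5 hf v u2 w w' z (adj-sym u2v) u2w ww' (adj-sym zw') zv
                   vw vw' u2w' (adj-sym zu2) (adj-sym zw))

  -- Let x ≠ w be common neighbours of an edge pq, with private neighbours y
  -- of x and w' of w (both missing p, q), where x ~ y, and let t see y and w'
  -- but none of x, w, p.  Then x ~ w: otherwise one of p q x w y, p q x w w'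
  -- is a paraglider, or x y w' w p is a C5, or x y t w' w p is a C6.
  joined-via-private-neighbours : HoleFree G → ParagliderFree G → (x y w w' p q t : V G)
    → p ~ q → p ~ x → q ~ x → p ~ w → q ~ w
    → x ~ y → p ≁ y → q ≁ y
    → w ~ w' → p ≁ w' → q ≁ w'
    → t ~ y → t ~ w' → t ≁ x → t ≁ w → t ≁ p
    → x ≢ w → x ~ w
  joined-via-private-neighbours hf pf x y w w' p q t
    pq px qx pw qw xy py qy ww' pw' qw' ty tw' tx tw tp x≢w with adj G x w in xw
  ... | true = refl
  ... | false with adj G y w in yw
  ...   | true = ⊥-elim (no-paraglider pf p q x w y x≢w pq px pw qx qw xy (adj-sym yw) py qy xw)
  ...   | false with adj G x w' in xw'
  ...     | true = ⊥-elim (no-paraglider pf p q x w w' x≢w pq px pw qx qw xw' ww' pw' qw' xw)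
  ...     | false with adj G y w' in yw'
  ...       | true = ⊥-elim (no-C5 hf x y w' w p xy yw' (adj-sym ww') (adj-sym pw) px
                       xw' xw yw (adj-sym py) (adj-sym pw'))
  ...       | false = ⊥-elim (no-C6 hf x y t w' w p xy (adj-sym ty) tw' (adj-sym ww') (adj-sym pw) px
                       (adj-sym tx) xw' xw yw' yw (adj-sym py) tw tp (adj-sym pw'))

  -- Let the edge wy be complete to z, let y ~ x with x ≠ z non-adjacent, and
  -- let p be a common neighbour of x and z missing w and y.  Then x ≁ w,
  -- since otherwise w y x z p is a paraglider.
  missed-by-paraglider : ParagliderFree G → (x y z w p : V G)
    → w ~ y → w ~ z → y ~ x → y ~ z → x ≁ z → x ≢ z
    → x ~ p → z ~ p → w ≁ p → y ≁ p → x ≁ w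
  missed-by-paraglider pf x y z w p wy wz yx yz xz x≢z xp zp wp yp with adj G x w in xw
  ... | false = refl
  ... | true = ⊥-elim (no-paraglider pf w y x z p x≢z wy (adj-sym xw) wz yx yz xp zp wp yp xz)

module Matched (G : Graph) where
  open Copies G

  matched-edge : (B : MatchedCoBip G) (j : Fin (k B)) → l B j ~ r B j
  matched-edge B j = trans (matching B j j) (⌊⌋-true (j ≟ j) refl)

  unmatched-nonedge : (B : MatchedCoBip G) {i j : Fin (k B)} → i ≢ j → l B i ≁ r B j
  unmatched-nonedge B {i} {j} i≢j = trans (matching B i j) (⌊⌋-false (i ≟ j) i≢j)

  adjacent⇒same-index : (B : MatchedCoBip G) {i j : Fin (k B)} → l B i ~ r B j → i ≡ j
  adjacent⇒same-index B {i} {j} lr with i ≟ j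
  ... | yes i≡j = i≡j
  ... | no i≢j with trans (≡-sym lr) (unmatched-nonedge B i≢j)
  ...   | ()

  extend : (B : MatchedCoBip G) (x y : V G) → ¬ (x ∈MCB B) → ¬ (y ∈MCB B) → x ~ y
    → (∀ j → x ~ l B j) → (∀ j → x ≁ r B j) → (∀ j → y ~ r B j) → (∀ j → y ≁ l B j)
    → Σ (MatchedCoBip G) λ B′ → (∀ v → v ∈MCB B → v ∈MCB B′) × x ∈MCB B′
  extend B x y x∉B y∉B xy x~l x≁r y~r y≁l = B′ , enlarged , (zero , inj₁ refl)
    where
    L R : Fin (ℕ.suc (k B)) → V G
    L = x Vector.∷ l B
    R = y Vector.∷ r B

    L-inj : Injective _≡_ _≡_ L
    L-inj {zero} {zero} _ = refl
    L-inj {zero} {suc j} e = ⊥-elim (x∉B (j , inj₁ (≡-sym e)))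
    L-inj {suc i} {zero} e = ⊥-elim (x∉B (i , inj₁ e))
    L-inj {suc i} {suc j} e = cong suc (l-inj B e)

    R-inj : Injective _≡_ _≡_ R
    R-inj {zero} {zero} _ = refl
    R-inj {zero} {suc j} e = ⊥-elim (y∉B (j , inj₂ (≡-sym e)))
    R-inj {suc i} {zero} e = ⊥-elim (y∉B (i , inj₂ e))
    R-inj {suc i} {suc j} e = cong suc (r-inj B e)

    disjoint′ : ∀ i j → L i ≢ R j
    disjoint′ zero zero = adjacent⇒distinct xy
    disjoint′ zero (suc j) e = x∉B (j , inj₂ (≡-sym e))
    disjoint′ (suc i) zero e = y∉B (i , inj₁ e)
    disjoint′ (suc i) (suc j) = disjoint B i j

    L-clique : ∀ i j → i ≢ j → L i ~ L j
    L-clique zero zero i≢j = ⊥-elim (i≢j refl)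
    L-clique zero (suc j) _ = x~l j
    L-clique (suc i) zero _ = adj-sym (x~l i)
    L-clique (suc i) (suc j) i≢j = l-clique B i j (i≢j ∘ cong suc)

    R-clique : ∀ i j → i ≢ j → R i ~ R j
    R-clique zero zero i≢j = ⊥-elim (i≢j refl)
    R-clique zero (suc j) _ = y~r j
    R-clique (suc i) zero _ = adj-sym (y~r i)
    R-clique (suc i) (suc j) i≢j = r-clique B i j (i≢j ∘ cong suc)

    matching′ : ∀ i j → adj G (L i) (R j) ≡ ⌊ i ≟ j ⌋
    matching′ zero zero = xy
    matching′ zero (suc j) = x≁r j
    matching′ (suc i) zero = adj-sym (y≁l i)
    matching′ (suc i) (suc j) = trans (matching B i j) (≡-sym (⌊⌋-map′ _ _ (i ≟ j)))

    B′ : MatchedCoBip G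
    B′ = record { k = ℕ.suc (k B) ; l = L ; r = R ; l-inj = L-inj ; r-inj = R-inj
                ; disjoint = disjoint′ ; l-clique = L-clique ; r-clique = R-clique
                ; matching = matching′ }

    enlarged : ∀ v → v ∈MCB B → v ∈MCB B′
    enlarged v (i , v∈) = suc i , v∈

isLeft-left : ∀ (i : Fin 3) → isLeft (i ↑ˡ 3) ≡ true
isLeft-left i0 = refl
isLeft-left i1 = refl
isLeft-left i2 = refl

isLeft-right : ∀ (i : Fin 3) → isLeft (3 ↑ʳ i) ≡ false
isLeft-right i0 = refl
isLeft-right i1 = refl
isLeft-right i2 = refl

module Proposition (G : Graph) (hf : HoleFree G) (pf : ParagliderFree G)
    (a : Fin 6 → V G) (copy : InducedCopy G coC6Adj a) (As : MatchedCoBip G)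
    (left⊆ : ∀ (i : Fin 3) → Σ (Fin (k As)) λ j → l As j ≡ a (i ↑ˡ 3))
    (right⊆ : ∀ (i : Fin 3) → Σ (Fin (k As)) λ j → r As j ≡ a (3 ↑ʳ i)) where
  open Copies G
  open Forbidden G
  open Matched G

  a-pattern : ∀ i j → adj G (a i) (a j) ≡ coC6Adj i j
  a-pattern = proj₂ copy

  aL aR : Fin 3 → V G
  aL i = a (i ↑ˡ 3)
  aR i = a (3 ↑ʳ i)

  L R : Fin 3 → Fin (k As)
  L i = proj₁ (left⊆ i)
  R i = proj₁ (right⊆ i)

  -- A's matching edges aL i aR i are matching edges of A*, so L = R
  L≡R : ∀ i → L i ≡ R i
  L≡R i = adjacent⇒same-index As
            (subst₂ _~_ (≡-sym (proj₂ (left⊆ i))) (≡-sym (proj₂ (right⊆ i))) (matched i))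
    where
    matched : ∀ i → aL i ~ aR i
    matched i0 = a-pattern i0 i3
    matched i1 = a-pattern i1 i4
    matched i2 = a-pattern i2 i5

  left-at : ∀ {i j} → j ≡ L i → l As j ≡ aL i
  left-at {i} refl = proj₂ (left⊆ i)

  right-at : ∀ {i j} → j ≡ L i → r As j ≡ aR i
  right-at {i} j≡Li = trans (cong (r As) (trans j≡Li (L≡R i))) (proj₂ (right⊆ i))

  Extra : Fin (k As) → Set
  Extra j = ∀ i → j ≢ L i

  position : ∀ j → (∃ λ i → j ≡ L i) ⊎ Extra j
  position j with any? (λ i → j ≟ L i)
  ... | yes found = inj₁ found
  ... | no none = inj₂ (λ i j≡Li → none (i , j≡Li))

  module ExtraIndex (j : Fin (k As)) (extra : Extra j) where
    lj~aL : ∀ i → l As j ~ aL i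
    lj~aL i = trans (cong (adj G (l As j)) (≡-sym (left-at refl))) (l-clique As j (L i) (extra i))

    lj≁aR : ∀ i → l As j ≁ aR i
    lj≁aR i = trans (cong (adj G (l As j)) (≡-sym (right-at refl)))
                (unmatched-nonedge As (extra i))

    rj~aR : ∀ i → r As j ~ aR i
    rj~aR i = trans (cong (adj G (r As j)) (≡-sym (right-at refl))) (r-clique As j (L i) (extra i))

    rj≁aL : ∀ i → r As j ≁ aL i
    rj≁aL i = adj-sym (trans (cong (λ u → adj G u (r As j)) (≡-sym (left-at refl)))
                (unmatched-nonedge As (extra i ∘ ≡-sym)))

  -- Part (i): a vertex complete to A sees every vertex of A*.  At an extra
  -- index, l j (say) is a common neighbour of a0 a1 with private neighbour
  -- r j, joined to v through a5.
  A6-complete : ∀ v → InA6 G a v → ∀ w → w ∈MCB As → adj G v w ≡ true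
  A6-complete v (_ , v~a) w (j , w∈) with position j | w∈
  ... | inj₁ (i , j≡Li) | inj₁ refl = trans (cong (adj G v) (left-at j≡Li)) (v~a (i ↑ˡ 3))
  ... | inj₁ (i , j≡Li) | inj₂ refl = trans (cong (adj G v) (right-at j≡Li)) (v~a (3 ↑ʳ i))
  ... | inj₂ extra | inj₁ refl =
    joined-via-private-neighbour hf pf (a i0) (a i1) v (l As j) (r As j) (a i5)
      (a-pattern i0 i1) (adj-sym (v~a i0)) (adj-sym (v~a i1)) (adj-sym (lj~aL i0)) (adj-sym (lj~aL i1))
      (matched-edge As j) (adj-sym (rj≁aL i0)) (adj-sym (rj≁aL i1))
      (adj-sym (v~a i5)) (adj-sym (rj~aR i2)) (a-pattern i5 i1) (adj-sym (lj≁aR i2))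
    where open ExtraIndex j extra
  ... | inj₂ extra | inj₂ refl =
    joined-via-private-neighbour hf pf (a i3) (a i4) v (r As j) (l As j) (a i2)
      (a-pattern i3 i4) (adj-sym (v~a i3)) (adj-sym (v~a i4)) (adj-sym (rj~aR i0)) (adj-sym (rj~aR i1))
      (adj-sym (matched-edge As j)) (adj-sym (lj≁aR i0)) (adj-sym (lj≁aR i1))
      (adj-sym (v~a i2)) (adj-sym (lj~aL i2)) (a-pattern i2 i4) (adj-sym (rj≁aL i2))
    where open ExtraIndex j extra

  module AdjacentPair (x y : V G) (x∉ : ¬ (x ∈MCB As)) (y∉ : ¬ (y ∈MCB As))
      (x-a : ∀ i → adj G x (a i) ≡ isLeft i) (y-a : ∀ i → adj G y (a i) ≡ not (isLeft i))
      (xy : x ~ y) where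

    -- at an extra index, x and l j are common neighbours of a0 a1 with
    -- private neighbours y and r j, which a4 joins
    x-sees-left : ∀ j → x ~ l As j
    x-sees-left j with position j
    ... | inj₁ (i , j≡Li) =
      trans (cong (adj G x) (left-at j≡Li)) (trans (x-a (i ↑ˡ 3)) (isLeft-left i))
    ... | inj₂ extra =
      joined-via-private-neighbours hf pf x y (l As j) (r As j) (a i0) (a i1) (a i4)
        (a-pattern i0 i1) (adj-sym (x-a i0)) (adj-sym (x-a i1)) (adj-sym (lj~aL i0)) (adj-sym (lj~aL i1))
        xy (adj-sym (y-a i0)) (adj-sym (y-a i1))
        (matched-edge As j) (adj-sym (rj≁aL i0)) (adj-sym (rj≁aL i1))
        (adj-sym (y-a i4)) (adj-sym (rj~aR i1)) (adj-sym (x-a i4)) (adj-sym (lj≁aR i1)) (a-pattern i4 i0)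
        (λ e → x∉ (j , inj₁ (≡-sym e)))
      where open ExtraIndex j extra

    -- symmetrically, y and r j over a3 a4, with private neighbours x, l j and a1
    y-sees-right : ∀ j → y ~ r As j
    y-sees-right j with position j
    ... | inj₁ (i , j≡Li) =
      trans (cong (adj G y) (right-at j≡Li)) (trans (y-a (3 ↑ʳ i)) (cong not (isLeft-right i)))
    ... | inj₂ extra =
      joined-via-private-neighbours hf pf y x (r As j) (l As j) (a i3) (a i4) (a i1)
        (a-pattern i3 i4) (adj-sym (y-a i3)) (adj-sym (y-a i4)) (adj-sym (rj~aR i0)) (adj-sym (rj~aR i1))
        (adj-sym xy) (adj-sym (x-a i3)) (adj-sym (x-a i4))
        (adj-sym (matched-edge As j)) (adj-sym (lj≁aR i0)) (adj-sym (lj≁aR i1))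
        (adj-sym (x-a i1)) (adj-sym (lj~aL i1)) (adj-sym (y-a i1)) (adj-sym (rj≁aL i1)) (a-pattern i1 i3)
        (λ e → y∉ (j , inj₂ (≡-sym e)))
      where open ExtraIndex j extra

    -- the edge r j y is complete to a3, and a0 sees x and a3 but not r j, y
    x-misses-right : ∀ j → x ≁ r As j
    x-misses-right j with position j
    ... | inj₁ (i , j≡Li) =
      trans (cong (adj G x) (right-at j≡Li)) (trans (x-a (3 ↑ʳ i)) (isLeft-right i))
    ... | inj₂ extra =
      missed-by-paraglider pf x y (a i3) (r As j) (a i0)
        (adj-sym (y-sees-right j)) (rj~aR i0) (adj-sym xy) (y-a i3) (x-a i3)
        (distinct-by (x-a i1) (a-pattern i3 i1))
        (x-a i0) (a-pattern i3 i0) (rj≁aL i0) (y-a i0)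
      where open ExtraIndex j extra

    -- the edge l j x is complete to a0, and a3 sees y and a0 but not l j, x
    y-misses-left : ∀ j → y ≁ l As j
    y-misses-left j with position j
    ... | inj₁ (i , j≡Li) =
      trans (cong (adj G y) (left-at j≡Li)) (trans (y-a (i ↑ˡ 3)) (cong not (isLeft-left i)))
    ... | inj₂ extra =
      missed-by-paraglider pf y x (a i0) (l As j) (a i3)
        (adj-sym (x-sees-left j)) (lj~aL i0) xy (x-a i0) (y-a i0)
        (distinct-by (y-a i4) (a-pattern i0 i4))
        (y-a i3) (a-pattern i0 i3) (lj≁aR i0) (x-a i3)
      where open ExtraIndex j extra

    extension : Σ (MatchedCoBip G) λ B → (∀ v → v ∈MCB As → v ∈MCB B) × x ∈MCB B
    extension = extend As x y x∉ y∉ xy x-sees-left x-misses-right y-sees-right y-misses-left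

  left-right-nonadjacent :
    (∀ (B : MatchedCoBip G) → (∀ v → v ∈MCB As → v ∈MCB B) → ∀ v → v ∈MCB B → v ∈MCB As)
    → ∀ x y → InA3 G a x → InA3 G a y → ¬ (x ∈MCB As) → ¬ (y ∈MCB As)
    → (∀ i → adj G x (a i) ≡ isLeft i)
    → (∀ i → adj G y (a i) ≡ not (isLeft i))
    → adj G x y ≡ false
  left-right-nonadjacent maximal x y _ _ x∉ y∉ x-a y-a with adj G x y in xy
  ... | false = refl
  ... | true with AdjacentPair.extension x y x∉ y∉ x-a y-a xy
  ...   | B , As⊆B , x∈B = ⊥-elim (x∉ (maximal B As⊆B x x∈B))

proposition7 : (G : Graph) → HoleFree G → ParagliderFree G
    → (a : Fin 6 → V G) → InducedCopy G coC6Adj a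
    → (As : MatchedCoBip G)
    → (∀ (i : Fin 3) → Σ (Fin (k As)) λ j → l As j ≡ a (i ↑ˡ 3))
    → (∀ (i : Fin 3) → Σ (Fin (k As)) λ j → r As j ≡ a (3 ↑ʳ i))
    → (∀ (B : MatchedCoBip G) → (∀ v → v ∈MCB As → v ∈MCB B) → ∀ v → v ∈MCB B → v ∈MCB As)
    → (∀ v → InA6 G a v → ∀ w → w ∈MCB As → adj G v w ≡ true)
      × (∀ x y → InA3 G a x → InA3 G a y → ¬ (x ∈MCB As) → ¬ (y ∈MCB As)
          → (∀ i → adj G x (a i) ≡ isLeft i)
          → (∀ i → adj G y (a i) ≡ not (isLeft i))
          → adj G x y ≡ false)
proposition7 G hf pf a copy As left⊆ right⊆ maximal =
  A6-complete , left-right-nonadjacent maximal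
  where open Proposition G hf pf a copy As left⊆ right⊆
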